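{- Let $G$ be a connected graph of order $5$. Then $rx_4(G)=3$ if and only if $\overline{G}$ is isomorphic to a subgraph of $P_5$ or of $K_2\cup K_3$.
   Context: For a connected graph $G$, an edge-coloring $c:E(G)\to\{1,\dots,q\}$ (adjacent edges may get the same color) is a $4$-rainbow coloring if for every set $S$ of $4$ vertices there is a tree in $G$ containing $S$ whose edges have pairwise distinct colors. $rx_4(G)$ is the minimum $q$ for which such a coloring exists. $\overline{G}$ is the complement of $G$; $P_m$, $K_m$ are the path and complete graph on $m$ vertices; $\cup$ is disjoint union. -}

module Defs where

open import Data.Bool using (Bool; true; false; not; if_then_else_; _∧_; _∨_)
open import Data.Bool.Properties using (∨-comm)
open import Data.Nat using (ℕ; zero; suc; _<_; _≡ᵇ_; _<ᵇ_)
open import Data.Fin using (Fin; zero; suc; toℕ; inject₁; fromℕ; _≟_)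
open import Data.Fin.Subset using (Subset; _∈_; ∣_∣)
open import Data.Product using (Σ; ∃; _×_; _,_)
open import Data.Sum using (_⊎_)
open import Relation.Nullary using (¬_; yes; no; does)
open import Relation.Binary.PropositionalEquality using (_≡_; refl; sym)
open import Function.Definitions using (Injective)
open import Data.Empty using (⊥-elim)

record Graph (n : ℕ) : Set where
  field
    adj     : Fin n → Fin n → Bool
    adj-sym : ∀ u v → adj u v ≡ adj v u
    adj-irr : ∀ u → adj u u ≡ false
open Graph public

Adj : ∀ {n} → Graph n → Fin n → Fin n → Set
Adj G u v = adj G u v ≡ true

mask : ∀ {n} → (Fin n → Fin n → Bool) → Fin n → Fin n → Bool
mask r u v = if does (u ≟ v) then false else r u v

mask-sym : ∀ {n} (r : Fin n → Fin n → Bool) → (∀ u v → r u v ≡ r v u) →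
           ∀ u v → mask r u v ≡ mask r v u
mask-sym r rs u v with u ≟ v | v ≟ u
... | yes _ | yes _ = refl
... | yes p | no q  = ⊥-elim (q (sym p))
... | no q  | yes p = ⊥-elim (q (sym p))
... | no _  | no _  = rs u v

mask-irr : ∀ {n} (r : Fin n → Fin n → Bool) → ∀ u → mask r u u ≡ false
mask-irr r u with u ≟ u
... | yes _ = refl
... | no q  = ⊥-elim (q refl)

mkGraph : ∀ {n} (r : Fin n → Fin n → Bool) → (∀ u v → r u v ≡ r v u) → Graph n
mkGraph r rs = record { adj = mask r ; adj-sym = mask-sym r rs ; adj-irr = mask-irr r }

complement : ∀ {n} → Graph n → Graph n
complement G = mkGraph (λ u v → not (adj G u v)) (λ u v → cong-not (adj-sym G u v))
  where
  cong-not : ∀ {a b : Bool} → a ≡ b → not a ≡ not b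
  cong-not refl = refl

pathRel : ∀ {m} → Fin m → Fin m → Bool
pathRel i j = (suc (toℕ i) ≡ᵇ toℕ j) ∨ (suc (toℕ j) ≡ᵇ toℕ i)

P : (m : ℕ) → Graph m
P m = mkGraph pathRel (λ i j → ∨-comm (suc (toℕ i) ≡ᵇ toℕ j) (suc (toℕ j) ≡ᵇ toℕ i))

-- K_a ∪ K_b on Fin m (m = a + b): vertices < a form K_a, the rest K_b
sameSide : ∀ {m} → ℕ → Fin m → Fin m → Bool
sameSide a i j = eqB (toℕ i <ᵇ a) (toℕ j <ᵇ a)
  where
  eqB : Bool → Bool → Bool
  eqB true  y = y
  eqB false y = not y

sameSide-sym : ∀ {m} a (i j : Fin m) → sameSide a i j ≡ sameSide a j i
sameSide-sym a i j with toℕ i <ᵇ a | toℕ j <ᵇ a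
... | true  | true  = refl
... | true  | false = refl
... | false | true  = refl
... | false | false = refl

KK : (a b : ℕ) → Graph (a Data.Nat.+ b)
KK a b = mkGraph (sameSide a) (sameSide-sym a)

_⊑_ : ∀ {n m} → Graph n → Graph m → Set
_⊑_ {n} {m} H G = Σ (Fin n → Fin m) λ f →
  Injective _≡_ _≡_ f × (∀ u v → Adj H u v → Adj G (f u) (f v))

data Walk {n} (G : Graph n) : Fin n → Fin n → Set where
  here : ∀ {u} → Walk G u u
  step : ∀ {u w v} → Adj G u w → Walk G w v → Walk G u v

Connected : ∀ {n} → Graph n → Set
Connected {n} G = ∀ (u v : Fin n) → Walk G u v

data EWalk {n} (E : Fin n → Fin n → Bool) : Fin n → Fin n → Set where
  here : ∀ {u} → EWalk E u u
  step : ∀ {u w v} → E u w ≡ true → EWalk E w v → EWalk E u v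

-- a cycle in the edge set E: distinct vertices f 0, …, f m (m ≥ 2)
-- with f i ~ f (i+1) and f m ~ f 0
Cycle : ∀ {n} → (Fin n → Fin n → Bool) → Set
Cycle {n} E = Σ ℕ λ k → Σ (Fin (suc (suc (suc k))) → Fin n) λ f →
  Injective _≡_ _≡_ f ×
  (∀ (i : Fin (suc (suc k))) → E (f (inject₁ i)) (f (suc i)) ≡ true) ×
  (E (f (fromℕ (suc (suc k)))) (f zero) ≡ true)

record TreeIn {n} (G : Graph n) : Set where
  field
    V      : Subset n
    E      : Fin n → Fin n → Bool
    E-sym  : ∀ u v → E u v ≡ E v u
    E-adj  : ∀ u v → E u v ≡ true → Adj G u v
    E-V    : ∀ u v → E u v ≡ true → u ∈ V × v ∈ V
    conn   : ∀ u v → u ∈ V → v ∈ V → EWalk E u v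
    acyc   : ¬ Cycle E
open TreeIn public

-- an edge-colouring with colours Fin q (= {1,…,q}); given on all pairs
-- symmetrically, only the values on edges of G matter
record EdgeColouring (n q : ℕ) : Set where
  field
    col     : Fin n → Fin n → Fin q
    col-sym : ∀ u v → col u v ≡ col v u
open EdgeColouring public

Rainbow : ∀ {n q} {G : Graph n} → EdgeColouring n q → TreeIn G → Set
Rainbow c T = ∀ u v x y → E T u v ≡ true → E T x y ≡ true →
  col c u v ≡ col c x y → (u ≡ x × v ≡ y) ⊎ (u ≡ y × v ≡ x)

IsKRainbow : ∀ {n q} → ℕ → Graph n → EdgeColouring n q → Set
IsKRainbow {n} k G c = ∀ (S : Subset n) → ∣ S ∣ ≡ k →
  Σ (TreeIn G) λ T → (∀ x → x ∈ S → x ∈ V T) × Rainbow c T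

RxEq : ∀ {n} → ℕ → Graph n → ℕ → Set
RxEq {n} k G q =
  Σ (EdgeColouring n q) (IsKRainbow k G) ×
  (∀ q' → q' < q → ¬ Σ (EdgeColouring n q') (IsKRainbow k G))

-- A tree containing four vertices has at least three edges, and a rainbow tree has at most as
-- many edges as there are colours; hence rx₄(G) ≥ 3. Suppose three colours suffice and let Tᵥ be
-- the rainbow tree for the four vertices other than v. Having at most three edges, Tᵥ lies inside
-- G − v, so every G − v is connected and every bridge of G − v is an edge of Tᵥ; two bridges of
-- the same G − v therefore get different colours. An exhaustive search over the 2¹⁰ graphs on
-- five vertices shows that if every G − v is connected then either the complement of G embeds in
-- P₅ or in K₂ ∪ K₃, or there are four edges any two of which are bridges of a common G − v, which
-- would need four colours. Conversely, the complements of P₅ and of K₂ ∪ K₃ have explicit rainbow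
-- 3-colourings, and 4-rainbow colourings survive relabelling the vertices and adding edges.

module Submission where

open import Defs
open import Data.Bool using (Bool; true; false; not; _∧_)
import Data.Bool.Properties as Bool
open import Data.Empty using (⊥-elim)
open import Data.Fin using (Fin; zero; suc; _≟_; inject₁; fromℕ; punchOut)
open import Data.Fin.Patterns using (0F; 1F; 2F; 3F; 4F; 5F; 6F; 7F; 8F; 9F)
open import Data.Fin.Properties using (any?; 0≢1+n; suc-injective; punchOut-injective; injective⇒≤)
open import Data.Fin.Subset using (Subset; inside; outside; _∈_; _∉_; _⊆_; ∣_∣; ∁; ⁅_⁆; ⊥; _∩_; _∪_; ⋃)
open import Data.Fin.Subset.Properties
  using (_∈?_; _⊆?_; ∣p∣≤n; p⊂q⇒∣p∣<∣q∣; ∉⊥; x∈p∪q⁺; x∈p∪q⁻; ∣∁p∣≡n∸∣p∣; ∣⁅x⁆∣≡1; x∈⁅y⁆⇒x≡y; x∈⁅x⁆; x∈p∩q⁺; x∉p⇒x∈∁p; x∈∁p⇒x∉p)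
open import Data.List using (List; []; _∷_; concatMap; allFin)
import Data.List as List
open import Data.List.Relation.Unary.Any as Any using (Any)
open import Data.List.Relation.Unary.All as All using (All)
open import Data.List.Membership.Propositional using (find)
open import Data.Nat using (ℕ; zero; suc; _∸_; _≤_; _<_; z≤n; s≤s; _≤?_)
open import Data.Nat.Properties using (≤-refl; ≤-trans; 1+n≰n; <⇒≱)
open import Data.Product using (Σ; ∃; ∃₂; _×_; _,_; proj₁; proj₂)
import Data.Product as Product
open import Data.Sum using (_⊎_; inj₁; inj₂)
import Data.Sum as Sum
open import Data.Vec using (Vec; []; _∷_; here; there; lookup; tabulate; insertAt)
import Data.Vec as Vec
open import Data.Vec.Properties using (lookup∘tabulate; []=⇒lookup; lookup⇒[]=)
open import Data.Vec.Relation.Unary.AllPairs using ([]; _∷_)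
open import Data.Vec.Relation.Unary.All using ([]; _∷_)
open import Data.Vec.Relation.Unary.Unique.Propositional using (Unique)
open import Data.Vec.Relation.Unary.Unique.Propositional.Properties using (lookup-injective)
open import Function using (_∘_; id)
open import Function.Bundles using (_⇔_; mk⇔)
open import Function.Definitions using (Injective)
open import Relation.Nullary using (¬_; Dec; yes; no; does; contradiction)
open import Relation.Nullary.Decidable using (map′; from-yes; decidable-stable; _×-dec_; _⊎-dec_; _→-dec_; ¬?)
open import Relation.Binary.PropositionalEquality
  using (_≡_; _≢_; refl; sym; trans; cong; cong₂; subst; subst₂)

≢⇒not-does : ∀ {n} {u v : Fin n} → u ≢ v → not (does (u ≟ v)) ≡ true
≢⇒not-does {u = u} {v} u≢v with u ≟ v
... | yes u≡v = contradiction u≡v u≢v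
... | no  _   = refl

∈-tabulate⁻ : ∀ {n} (f : Fin n → Bool) {x} → x ∈ tabulate f → f x ≡ true
∈-tabulate⁻ f {x} x∈ = trans (sym (lookup∘tabulate f x)) ([]=⇒lookup x∈)

∈-tabulate⁺ : ∀ {n} (f : Fin n → Bool) {x} → f x ≡ true → x ∈ tabulate f
∈-tabulate⁺ f {x} fx = lookup⇒[]= x _ (trans (lookup∘tabulate f x) fx)

-- Data.Fin.Properties.all? goes through decFinSubset and is far slower to evaluate.
∀-Fin? : ∀ {n} {P : Fin n → Set} → (∀ x → Dec (P x)) → Dec (∀ x → P x)
∀-Fin? {zero}  P? = yes λ ()
∀-Fin? {suc n} P? = map′ (λ { (P0 , Ps) zero → P0 ; (P0 , Ps) (suc x) → Ps x }) (λ ∀P → ∀P zero , ∀P ∘ suc)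
                         (P? zero ×-dec ∀-Fin? (P? ∘ suc))

∀-Subset? : ∀ {n} {P : Subset n → Set} → (∀ p → Dec (P p)) → Dec (∀ p → P p)
∀-Subset? {zero} P? = map′ (λ { P[] [] → P[] }) (λ ∀P → ∀P []) (P? [])
∀-Subset? {suc n} P? =
  map′ (λ { (Pin , Pout) (inside ∷ p) → Pin p ; (Pin , Pout) (outside ∷ p) → Pout p })
       (λ ∀P → (λ p → ∀P (inside ∷ p)) , (λ p → ∀P (outside ∷ p)))
       (∀-Subset? (λ p → P? (inside ∷ p)) ×-dec ∀-Subset? (λ p → P? (outside ∷ p)))

∈∁⁅⁆⁺ : ∀ {n} {x v : Fin n} → x ≢ v → x ∈ ∁ ⁅ v ⁆
∈∁⁅⁆⁺ x≢v = x∉p⇒x∈∁p (x≢v ∘ x∈⁅y⁆⇒x≡y _)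

∈∁⁅⁆⁻ : ∀ {n} {x v : Fin n} → x ∈ ∁ ⁅ v ⁆ → x ≢ v
∈∁⁅⁆⁻ {v = v} x∈ refl = x∈∁p⇒x∉p x∈ (x∈⁅x⁆ v)

∣∁⁅x⁆∣≡n : ∀ {n} (x : Fin (suc n)) → ∣ ∁ ⁅ x ⁆ ∣ ≡ n
∣∁⁅x⁆∣≡n {n} x = trans (∣∁p∣≡n∸∣p∣ ⁅ x ⁆) (cong (suc n ∸_) (∣⁅x⁆∣≡1 x))

∣p∣<n⇒∃∉p : ∀ {n} (p : Subset n) → ∣ p ∣ < n → ∃ λ x → x ∉ p
∣p∣<n⇒∃∉p (outside ∷ p) _            = zero , λ ()
∣p∣<n⇒∃∉p (inside  ∷ p) (s≤s ∣p∣<n) with ∣p∣<n⇒∃∉p p ∣p∣<n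
... | x , x∉p = suc x , λ { (there x∈p) → x∉p x∈p }

injectiveOn⇒∣p∣≤ : ∀ {n q} (p : Subset n) (f : ∀ x → x ∈ p → Fin q) →
  (∀ {x y} (x∈p : x ∈ p) (y∈p : y ∈ p) → f x x∈p ≡ f y y∈p → x ≡ y) → ∣ p ∣ ≤ q
injectiveOn⇒∣p∣≤ []            f inj = z≤n
injectiveOn⇒∣p∣≤ (outside ∷ p) f inj =
  injectiveOn⇒∣p∣≤ p (λ x x∈p → f (suc x) (there x∈p)) (λ x∈p y∈p → suc-injective ∘ inj (there x∈p) (there y∈p))
injectiveOn⇒∣p∣≤ {q = zero}  (inside ∷ p) f inj with f zero here
... | ()
injectiveOn⇒∣p∣≤ {q = suc q} (inside ∷ p) f inj = s≤s (injectiveOn⇒∣p∣≤ p g g-injective)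
  where
  g : ∀ x → x ∈ p → Fin q
  g x x∈p = punchOut {i = f zero here} {j = f (suc x) (there x∈p)} (0≢1+n ∘ inj here (there x∈p))
  g-injective : ∀ {x y} (x∈p : x ∈ p) (y∈p : y ∈ p) → g x x∈p ≡ g y y∈p → x ≡ y
  g-injective x∈p y∈p eq = suc-injective (inj (there x∈p) (there y∈p) (punchOut-injective {i = f zero here} _ _ eq))

injective⇒surjective : ∀ {n} {f : Fin n → Fin n} → Injective _≡_ _≡_ f → ∀ y → ∃ λ x → f x ≡ y
injective⇒surjective {suc n} {f} f-injective y with any? (λ x → f x ≟ y)
... | yes hit = hit
... | no miss = contradiction (injective⇒≤ g-injective) 1+n≰n
  where
  g : Fin (suc n) → Fin n
  g x = punchOut {i = y} {j = f x} (λ y≡fx → miss (x , sym y≡fx))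
  g-injective : Injective _≡_ _≡_ g
  g-injective eq = f-injective (punchOut-injective {i = y} _ _ eq)

FourClique : ∀ {n} → (Fin n → Fin n → Set) → Set
FourClique R = ∃ λ a → ∃ λ b → R a b × ∃ λ c → (R a c × R b c) × ∃ λ d → R a d × R b d × R c d

fourClique? : ∀ {n} {R : Fin n → Fin n → Set} → (∀ a b → Dec (R a b)) → Dec (FourClique R)
fourClique? R? = any? λ a → any? λ b → R? a b ×-dec any? λ c → (R? a c ×-dec R? b c) ×-dec
                 any? λ d → R? a d ×-dec R? b d ×-dec R? c d

FourClique-map : ∀ {n} {R R′ : Fin n → Fin n → Set} → (∀ {a b} → R a b → R′ a b) → FourClique R → FourClique R′
FourClique-map h (a , b , ab , c , (ac , bc) , d , ad , bd , cd) =
  a , b , h ab , c , (h ac , h bc) , d , h ad , h bd , h cd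

FourClique-≢⇒4≤ : ∀ {n q} (f : Fin n → Fin q) → FourClique (λ a b → f a ≢ f b) → 4 ≤ q
FourClique-≢⇒4≤ f (a , b , ab , c , (ac , bc) , d , ad , bd , cd) =
  injective⇒≤ (λ {i} {j} → lookup-injective distinct i j)
  where
  distinct : Unique (f a ∷ f b ∷ f c ∷ f d ∷ [])
  distinct = (ab ∷ ac ∷ ad ∷ []) ∷ (bc ∷ bd ∷ []) ∷ (cd ∷ []) ∷ [] ∷ []

module _ {n : ℕ} where

  EWalk-map : ∀ {m} {E : Fin n → Fin n → Bool} {E′ : Fin m → Fin m → Bool} (h : Fin n → Fin m) →
    (∀ {a b} → E a b ≡ true → E′ (h a) (h b) ≡ true) → ∀ {a b} → EWalk E a b → EWalk E′ (h a) (h b)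
  EWalk-map h hom here       = here
  EWalk-map h hom (step e w) = step (hom e) (EWalk-map h hom w)

  EWalk-++ : ∀ {E : Fin n → Fin n → Bool} {a b c} → EWalk E a b → EWalk E b c → EWalk E a c
  EWalk-++ here       w′ = w′
  EWalk-++ (step e w) w′ = step e (EWalk-++ w w′)

  EWalk-reverse : ∀ {E : Fin n → Fin n → Bool} → (∀ a b → E a b ≡ E b a) → ∀ {a b} → EWalk E a b → EWalk E b a
  EWalk-reverse E-sym here       = here
  EWalk-reverse E-sym (step e w) = EWalk-++ (EWalk-reverse E-sym w) (step (trans (E-sym _ _) e) here)

  path⇒EWalk : ∀ {m} {E : Fin n → Fin n → Bool} (g : Fin (suc m) → Fin n) →
    (∀ i → E (g (inject₁ i)) (g (suc i)) ≡ true) → EWalk E (g zero) (g (fromℕ m))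
  path⇒EWalk {zero}  g es = here
  path⇒EWalk {suc m} g es = step (es zero) (path⇒EWalk (g ∘ suc) (es ∘ suc))

  Outside : Fin n → Fin n → Fin n → Set
  Outside a b x = x ≢ a × x ≢ b

  -- Going round the rest of the cycle leads from f 1 back to f 0, and every edge
  -- on that way has an endpoint f i with i ≥ 2.
  cycle⇒detour : ∀ {E : Fin n → Fin n → Bool} → Cycle E → ∃₂ λ a b → E a b ≡ true ×
    (∀ {E′} → (∀ {x y} → E x y ≡ true → Outside a b x ⊎ Outside a b y → E′ x y ≡ true) → EWalk E′ b a)
  cycle⇒detour {E} (k , f , f-injective , es , closing) = f 0F , f 1F , es 0F , detour
    where
    far : ∀ i → Outside (f 0F) (f 1F) (f (suc (suc i)))
    far i = (λ ()) ∘ f-injective , (λ ()) ∘ suc-injective ∘ f-injective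
    detour : ∀ {E′} → (∀ {x y} → E x y ≡ true → Outside (f 0F) (f 1F) x ⊎ Outside (f 0F) (f 1F) y → E′ x y ≡ true) →
             EWalk E′ (f 1F) (f 0F)
    detour keep = EWalk-++ (path⇒EWalk (f ∘ suc) (λ i → keep (es (suc i)) (inj₂ (far i))))
                           (step (keep closing (inj₁ (far (fromℕ k)))) here)

image : ∀ {m n} → (Fin m → Subset n) → Subset m → Subset n
image R []            = ⊥
image R (inside  ∷ C) = R zero ∪ image (R ∘ suc) C
image R (outside ∷ C) = image (R ∘ suc) C

image⁺ : ∀ {m n} {R : Fin m → Subset n} {C a w} → a ∈ C → w ∈ R a → w ∈ image R C
image⁺ {C = inside  ∷ C} here       w∈Ra = x∈p∪q⁺ (inj₁ w∈Ra)
image⁺ {C = inside  ∷ C} (there a∈) w∈Ra = x∈p∪q⁺ (inj₂ (image⁺ a∈ w∈Ra))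
image⁺ {C = outside ∷ C} (there a∈) w∈Ra = image⁺ a∈ w∈Ra

image⁻ : ∀ {m n} (R : Fin m → Subset n) C {w} → w ∈ image R C → ∃ λ a → a ∈ C × w ∈ R a
image⁻ R []            w∈ = contradiction w∈ ∉⊥
image⁻ R (inside  ∷ C) w∈ with x∈p∪q⁻ (R zero) (image (R ∘ suc) C) w∈
... | inj₁ w∈R0   = zero , here , w∈R0
... | inj₂ w∈rest = Product.map suc (Product.map there id) (image⁻ (R ∘ suc) C w∈rest)
image⁻ R (outside ∷ C) w∈ = Product.map suc (Product.map there id) (image⁻ (R ∘ suc) C w∈)

module _ {n : ℕ} (X : Fin n → Fin n → Bool) where

  -- Via image, each step reads the previous set once, which keeps reach cheap to evaluate.
  expand : Subset n → Subset n
  expand = image λ a → ⁅ a ⁆ ∪ tabulate (X a)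

  Closed : Subset n → Set
  Closed C = ∀ {a b} → a ∈ C → X a b ≡ true → b ∈ C

  ⊆-expand : ∀ {C} → C ⊆ expand C
  ⊆-expand {C} {a} a∈C = image⁺ a∈C (x∈p∪q⁺ (inj₁ (x∈⁅x⁆ a)))

  expand⊆⇒Closed : ∀ {C} → expand C ⊆ C → Closed C
  expand⊆⇒Closed expand⊆C a∈C e = expand⊆C (image⁺ a∈C (x∈p∪q⁺ (inj₂ (∈-tabulate⁺ (X _) e))))

  Closed⇒expand⊆ : ∀ {C} → Closed C → expand C ⊆ C
  Closed⇒expand⊆ {C} closed w∈ with image⁻ _ C w∈
  ... | a , a∈ , w∈Ra with x∈p∪q⁻ ⁅ a ⁆ _ w∈Ra
  ...   | inj₁ w∈⁅a⁆ = subst (_∈ C) (sym (x∈⁅y⁆⇒x≡y a w∈⁅a⁆)) a∈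
  ...   | inj₂ w∈Xa  = closed a∈ (∈-tabulate⁻ (X a) w∈Xa)

  Closed-expand : ∀ {C} → Closed C → Closed (expand C)
  Closed-expand closed a∈ e = ⊆-expand (closed (Closed⇒expand⊆ closed a∈) e)

  EWalk-closed : ∀ {C a b} → Closed C → a ∈ C → EWalk X a b → b ∈ C
  EWalk-closed closed a∈C here       = a∈C
  EWalk-closed closed a∈C (step e w) = EWalk-closed closed (closed a∈C e) w

  reachIn : ℕ → Fin n → Subset n
  reachIn zero    r = ⁅ r ⁆
  reachIn (suc k) r = expand (reachIn k r)

  reachIn-sound : ∀ k {r w} → w ∈ reachIn k r → EWalk X r w
  reachIn-sound zero    w∈ = subst (EWalk X _) (sym (x∈⁅y⁆⇒x≡y _ w∈)) here
  reachIn-sound (suc k) w∈ with image⁻ _ (reachIn k _) w∈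
  ... | a , a∈ , w∈Ra with x∈p∪q⁻ ⁅ a ⁆ _ w∈Ra
  ...   | inj₁ w∈⁅a⁆ = subst (EWalk X _) (sym (x∈⁅y⁆⇒x≡y a w∈⁅a⁆)) (reachIn-sound k a∈)
  ...   | inj₂ w∈Xa  = EWalk-++ (reachIn-sound k a∈) (step (∈-tabulate⁻ (X a) w∈Xa) here)

  root∈reachIn : ∀ k r → r ∈ reachIn k r
  root∈reachIn zero    r = x∈⁅x⁆ r
  root∈reachIn (suc k) r = ⊆-expand (root∈reachIn k r)

  -- Until it becomes closed, the reachable set grows by at least one vertex per step.
  reachIn-closed⊎large : ∀ k r → Closed (reachIn k r) ⊎ k < ∣ reachIn k r ∣
  reachIn-closed⊎large zero    r = inj₂ (subst (0 <_) (sym (∣⁅x⁆∣≡1 r)) (s≤s z≤n))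
  reachIn-closed⊎large (suc k) r with reachIn-closed⊎large k r
  ... | inj₁ closed = inj₁ (Closed-expand closed)
  ... | inj₂ large with any? (λ x → (x ∈? reachIn (suc k) r) ×-dec ¬? (x ∈? reachIn k r))
  ...   | yes new = inj₂ (≤-trans (s≤s large) (p⊂q⇒∣p∣<∣q∣ (⊆-expand , new)))
  ...   | no  none = inj₁ (Closed-expand (expand⊆⇒Closed λ {x} x∈ →
                         decidable-stable (x ∈? reachIn k r) λ x∉ → none (x , x∈ , x∉)))

  -- Opaque because unfolding reach while solving unification constraints blows up;
  -- only the exhaustive checks below need to compute it.
  opaque
    reach : Fin n → Subset n
    reach = reachIn n

    reach-sound : ∀ {r w} → w ∈ reach r → EWalk X r w
    reach-sound = reachIn-sound n

    root∈reach : ∀ r → r ∈ reach r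
    root∈reach = root∈reachIn n

    reach-closed : ∀ r → Closed (reach r)
    reach-closed r with reachIn-closed⊎large n r
    ... | inj₁ closed = closed
    ... | inj₂ n<∣C∣   = contradiction (∣p∣≤n (reach r)) (<⇒≱ n<∣C∣)

  EWalk⇒reach : ∀ {r w} → EWalk X r w → w ∈ reach r
  EWalk⇒reach = EWalk-closed (reach-closed _) (root∈reach _)

reach-mono : ∀ {n} {X Y : Fin n → Fin n → Bool} → (∀ {a b} → X a b ≡ true → Y a b ≡ true) →
  ∀ r → reach X r ⊆ reach Y r
reach-mono {X = X} {Y} X⊆Y r = EWalk⇒reach Y ∘ EWalk-map id X⊆Y ∘ reach-sound X

-- Rainbow trees under relabelling and extra edges

RainbowTreeFor : ∀ {n q} → Graph n → EdgeColouring n q → Subset n → Set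
RainbowTreeFor G c S = Σ (TreeIn G) λ T → (∀ x → x ∈ S → x ∈ V T) × Rainbow c T

coatoms⇒IsKRainbow : ∀ {n q k} {G : Graph n} {c : EdgeColouring n q} → k < n →
  (∀ v → RainbowTreeFor G c (∁ ⁅ v ⁆)) → IsKRainbow k G c
coatoms⇒IsKRainbow k<n trees S ∣S∣≡k with ∣p∣<n⇒∃∉p S (subst (_< _) (sym ∣S∣≡k) k<n)
... | v , v∉S with trees v
...   | T , ∁⁅v⁆⊆V , rainbow = T , (λ x x∈S → ∁⁅v⁆⊆V x (∈∁⁅⁆⁺ λ { refl → v∉S x∈S })) , rainbow

TreeIn-mono : ∀ {n} {G G′ : Graph n} → (∀ {u v} → Adj G u v → Adj G′ u v) → TreeIn G → TreeIn G′
TreeIn-mono G⊆G′ T = record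
  { V = V T ; E = E T ; E-sym = E-sym T ; E-adj = λ u v → G⊆G′ ∘ E-adj T u v
  ; E-V = E-V T ; conn = conn T ; acyc = acyc T }

RainbowTreeFor-mono : ∀ {n q} {G G′ : Graph n} {c : EdgeColouring n q} {S} →
  (∀ {u v} → Adj G u v → Adj G′ u v) → RainbowTreeFor G c S → RainbowTreeFor G′ c S
RainbowTreeFor-mono G⊆G′ (T , S⊆V , rainbow) = TreeIn-mono G⊆G′ T , S⊆V , rainbow

_∘ᴳ_ : ∀ {n} → Graph n → (Fin n → Fin n) → Graph n
H ∘ᴳ f = record
  { adj     = λ u v → adj H (f u) (f v)
  ; adj-sym = λ u v → adj-sym H (f u) (f v)
  ; adj-irr = adj-irr H ∘ f
  }

_∘ᶜ_ : ∀ {n q} → EdgeColouring n q → (Fin n → Fin n) → EdgeColouring n q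
c ∘ᶜ f = record { col = λ u v → col c (f u) (f v) ; col-sym = λ u v → col-sym c (f u) (f v) }

preimage : ∀ {n} → (Fin n → Fin n) → Subset n → Subset n
preimage f S = tabulate λ x → lookup S (f x)

module Relabel {n} {f : Fin n → Fin n} (f-injective : Injective _≡_ _≡_ f) where

  private
    f⁻¹ : Fin n → Fin n
    f⁻¹ y = proj₁ (injective⇒surjective f-injective y)

    f∘f⁻¹ : ∀ y → f (f⁻¹ y) ≡ y
    f∘f⁻¹ y = proj₂ (injective⇒surjective f-injective y)

    f⁻¹∘f : ∀ x → f⁻¹ (f x) ≡ x
    f⁻¹∘f x = f-injective (f∘f⁻¹ (f x))

    ∈-preimage⁺ : ∀ {S x} → f x ∈ S → x ∈ preimage f S
    ∈-preimage⁺ {S} fx∈S = ∈-tabulate⁺ (λ x → lookup S (f x)) ([]=⇒lookup fx∈S)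

    ∈-preimage⁻ : ∀ {S x} → x ∈ preimage f S → f x ∈ S
    ∈-preimage⁻ {S} x∈ = lookup⇒[]= _ _ (∈-tabulate⁻ (λ x → lookup S (f x)) x∈)

  pullbackTree : ∀ {H} → TreeIn H → TreeIn (H ∘ᴳ f)
  pullbackTree T = record
    { V     = preimage f (V T)
    ; E     = λ u v → E T (f u) (f v)
    ; E-sym = λ u v → E-sym T (f u) (f v)
    ; E-adj = λ u v → E-adj T (f u) (f v)
    ; E-V   = λ u v → Product.map ∈-preimage⁺ ∈-preimage⁺ ∘ E-V T (f u) (f v)
    ; conn  = λ u v u∈V v∈V → subst₂ (EWalk _) (f⁻¹∘f u) (f⁻¹∘f v)
        (EWalk-map f⁻¹ (subst₂ (λ a b → E T a b ≡ true) (sym (f∘f⁻¹ _)) (sym (f∘f⁻¹ _)))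
          (conn T (f u) (f v) (∈-preimage⁻ u∈V) (∈-preimage⁻ v∈V)))
    ; acyc  = λ { (k , h , h-injective , es , closing) →
                  acyc T (k , f ∘ h , h-injective ∘ f-injective , es , closing) }
    }

  pullbackRainbowTree : ∀ {q} {H : Graph n} {c : EdgeColouring n q} {S S′} →
    RainbowTreeFor H c S → (∀ x → x ∈ S′ → f x ∈ S) → RainbowTreeFor (H ∘ᴳ f) (c ∘ᶜ f) S′
  pullbackRainbowTree (T , S⊆V , rainbow) S′⊆f⁻¹S =
      pullbackTree T
    , (λ x x∈S′ → ∈-preimage⁺ (S⊆V (f x) (S′⊆f⁻¹S x x∈S′)))
    , λ u v x y e e′ same → Sum.map (Product.map f-injective f-injective) (Product.map f-injective f-injective)
                                    (rainbow (f u) (f v) (f x) (f y) e e′ same)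

complement-adj⁻ : ∀ {n} {G : Graph n} {u v} → Adj (complement G) u v → u ≢ v × adj G u v ≡ false
complement-adj⁻ {G = G} {u} {v} h with u ≟ v | adj G u v
complement-adj⁻ () | yes _   | _
complement-adj⁻ () | no  _   | true
complement-adj⁻ _  | no  u≢v | false = u≢v , refl

complement-adj⁺ : ∀ {n} {G : Graph n} {u v} → u ≢ v → adj G u v ≡ false → Adj (complement G) u v
complement-adj⁺ {u = u} {v} u≢v non-edge with u ≟ v
... | yes u≡v = contradiction u≡v u≢v
... | no  _   rewrite non-edge = refl

complement-embedding⇒⊇ : ∀ {n} {G H : Graph n} (f : Fin n → Fin n) →
  (∀ u v → Adj (complement G) u v → Adj H (f u) (f v)) → ∀ {u v} → Adj (complement H ∘ᴳ f) u v → Adj G u v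
complement-embedding⇒⊇ {G = G} {H} f embeds {u} {v} h with complement-adj⁻ {G = H} h
... | fu≢fv , non-edge with adj G u v in eq
...   | true  = refl
...   | false = contradiction (trans (sym (embeds u v (complement-adj⁺ {G = G} (fu≢fv ∘ cong f) eq))) non-edge) λ ()

complement-⊑⇒IsKRainbow : ∀ {m q} {G H : Graph (suc m)} {c : EdgeColouring (suc m) q} →
  (∀ v → RainbowTreeFor (complement H) c (∁ ⁅ v ⁆)) → complement G ⊑ H → Σ (EdgeColouring (suc m) q) (IsKRainbow m G)
complement-⊑⇒IsKRainbow {G = G} {H} {c} trees (f , f-injective , embeds) =
  c ∘ᶜ f , coatoms⇒IsKRainbow {G = G} {c ∘ᶜ f} ≤-refl λ v →
    RainbowTreeFor-mono {G = complement H ∘ᴳ f} {c = c ∘ᶜ f} {S = ∁ ⁅ v ⁆} (complement-embedding⇒⊇ {G = G} {H} f embeds)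
      (Relabel.pullbackRainbowTree f-injective {H = complement H} {c} {∁ ⁅ f v ⁆} {∁ ⁅ v ⁆} (trees (f v))
        λ x x∈ → ∈∁⁅⁆⁺ (∈∁⁅⁆⁻ x∈ ∘ f-injective))

Edges : Set
Edges = Subset 10

-- An edge set is a subset of the ten pairs {lo p , hi p}, lo p < hi p, in lexicographic order.
lo hi : Fin 10 → Fin 5
lo 0F = 0F
lo 1F = 0F
lo 2F = 0F
lo 3F = 0F
lo 4F = 1F
lo 5F = 1F
lo 6F = 1F
lo 7F = 2F
lo 8F = 2F
lo 9F = 3F
hi 0F = 1F
hi 1F = 2F
hi 2F = 3F
hi 3F = 4F
hi 4F = 2F
hi 5F = 3F
hi 6F = 4F
hi 7F = 3F
hi 8F = 4F
hi 9F = 4F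

-- Inverse of lo and hi; the diagonal entries are junk.
pairIndex : Fin 5 → Fin 5 → Fin 10
pairIndex u v = lookup (lookup table u) v
  where
  table : Vec (Vec (Fin 10) 5) 5
  table = (0F ∷ 0F ∷ 1F ∷ 2F ∷ 3F ∷ [])
        ∷ (0F ∷ 0F ∷ 4F ∷ 5F ∷ 6F ∷ [])
        ∷ (1F ∷ 4F ∷ 0F ∷ 7F ∷ 8F ∷ [])
        ∷ (2F ∷ 5F ∷ 7F ∷ 0F ∷ 9F ∷ [])
        ∷ (3F ∷ 6F ∷ 8F ∷ 9F ∷ 0F ∷ [])
        ∷ []

pairIndex-sym : ∀ u v → pairIndex u v ≡ pairIndex v u
pairIndex-sym = from-yes (∀-Fin? λ u → ∀-Fin? λ v → pairIndex u v ≟ pairIndex v u)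

pairIndex-lo-hi : ∀ p → pairIndex (lo p) (hi p) ≡ p
pairIndex-lo-hi = from-yes (∀-Fin? λ p → pairIndex (lo p) (hi p) ≟ p)

lo≢hi : ∀ p → lo p ≢ hi p
lo≢hi = from-yes (∀-Fin? λ p → ¬? (lo p ≟ hi p))

pairIndex-injective : ∀ u v x y → u ≢ v → x ≢ y → pairIndex u v ≡ pairIndex x y →
  (u ≡ x × v ≡ y) ⊎ (u ≡ y × v ≡ x)
pairIndex-injective = from-yes (∀-Fin? λ u → ∀-Fin? λ v → ∀-Fin? λ x → ∀-Fin? λ y →
  ¬? (u ≟ v) →-dec ¬? (x ≟ y) →-dec (pairIndex u v ≟ pairIndex x y) →-dec
  ((u ≟ x ×-dec v ≟ y) ⊎-dec (u ≟ y ×-dec v ≟ x)))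

edge : Edges → Fin 5 → Fin 5 → Bool
edge t u v = not (does (u ≟ v)) ∧ lookup t (pairIndex u v)

edge⁻ : ∀ t {u v} → edge t u v ≡ true → u ≢ v × pairIndex u v ∈ t
edge⁻ t {u} {v} e with u ≟ v
edge⁻ t () | yes _
edge⁻ t e  | no u≢v = u≢v , lookup⇒[]= _ t e

edge⁺ : ∀ t {u v} → u ≢ v → pairIndex u v ∈ t → edge t u v ≡ true
edge⁺ t u≢v p∈t rewrite ≢⇒not-does u≢v = []=⇒lookup p∈t

edge-sym : ∀ t u v → edge t u v ≡ edge t v u
edge-sym t u v with u ≟ v | v ≟ u
... | yes _   | yes _   = refl
... | yes u≡v | no  v≢u = contradiction (sym u≡v) v≢u
... | no  u≢v | yes v≡u = contradiction (sym v≡u) u≢v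
... | no  _   | no  _   = cong (lookup t) (pairIndex-sym u v)

edge-mono : ∀ {t t′} → t ⊆ t′ → ∀ {a b} → edge t a b ≡ true → edge t′ a b ≡ true
edge-mono {t} {t′} t⊆t′ {a} {b} e with edge⁻ t {a} {b} e
... | a≢b , p∈t = edge⁺ t′ {a} {b} a≢b (t⊆t′ p∈t)

edgesOf : (Fin 5 → Fin 5 → Bool) → Edges
edgesOf r = tabulate λ p → r (lo p) (hi p)

∈-edgesOf⁻ : ∀ r {p} → p ∈ edgesOf r → r (lo p) (hi p) ≡ true
∈-edgesOf⁻ r = ∈-tabulate⁻ λ p → r (lo p) (hi p)

∈-edgesOf⁺ : ∀ r {p} → r (lo p) (hi p) ≡ true → p ∈ edgesOf r
∈-edgesOf⁺ r = ∈-tabulate⁺ λ p → r (lo p) (hi p)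

edge-edgesOf : ∀ (r : Fin 5 → Fin 5 → Bool) → (∀ u v → r u v ≡ r v u) → (∀ u → r u u ≡ false) →
  ∀ u v → edge (edgesOf r) u v ≡ r u v
edge-edgesOf r r-sym r-irr u v with u ≟ v
... | yes refl = sym (r-irr u)
... | no  u≢v  = trans (lookup∘tabulate (λ p → r (lo p) (hi p)) (pairIndex u v))
                       (ends (pairIndex-injective (lo p) (hi p) u v (lo≢hi p) u≢v (pairIndex-lo-hi p)))
  where
  p : Fin 10
  p = pairIndex u v
  ends : ∀ {a b} → (a ≡ u × b ≡ v) ⊎ (a ≡ v × b ≡ u) → r a b ≡ r u v
  ends (inj₁ (refl , refl)) = refl
  ends (inj₂ (refl , refl)) = r-sym v u

_∖_ : Edges → Fin 10 → Edges
t ∖ p = t ∩ ∁ ⁅ p ⁆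

avoiding : Fin 5 → Edges
avoiding v = edgesOf λ a b → not (does (a ≟ v)) ∧ not (does (b ≟ v))

_−ᵛ_ : Edges → Fin 5 → Edges
g −ᵛ v = g ∩ avoiding v

anchor : Fin 5 → Fin 5
anchor 0F      = 1F
anchor (suc _) = 0F

anchor∈ : ∀ v → anchor v ∈ ∁ ⁅ v ⁆
anchor∈ 0F      = ∈∁⁅⁆⁺ {v = 0F} λ ()
anchor∈ (suc v) = ∈∁⁅⁆⁺ {v = suc v} λ ()

Spans : Edges → Fin 5 → Set
Spans t v = ∁ ⁅ v ⁆ ⊆ reach (edge t) (anchor v)

spans? : ∀ t v → Dec (Spans t v)
spans? t v = ∁ ⁅ v ⁆ ⊆? reach (edge t) (anchor v)

Spans-mono : ∀ {t t′ v} → t ⊆ t′ → Spans t v → Spans t′ v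
Spans-mono {t} {t′} t⊆t′ spans = reach-mono (λ {a} {b} → edge-mono {t} {t′} t⊆t′ {a} {b}) _ ∘ spans

Spans⇒EWalk : ∀ {t v a b} → Spans t v → a ∈ ∁ ⁅ v ⁆ → b ∈ ∁ ⁅ v ⁆ → EWalk (edge t) a b
Spans⇒EWalk {t} spans a∈ b∈ =
  EWalk-++ (EWalk-reverse (edge-sym t) (reach-sound (edge t) (spans a∈))) (reach-sound (edge t) (spans b∈))

opaque
  unfolding reach

  spanning⇒3≤∣t∣ : ∀ t → Spans t 0F → 3 ≤ ∣ t ∣
  spanning⇒3≤∣t∣ = from-yes (∀-Subset? λ t → spans? t 0F →-dec (3 ≤? ∣ t ∣))

  small-spanning⇒avoiding : ∀ t v → ∣ t ∣ ≤ 3 → Spans t v → t ⊆ avoiding v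
  small-spanning⇒avoiding = from-yes (∀-Subset? λ t → ∀-Fin? λ v →
    (∣ t ∣ ≤? 3) →-dec spans? t v →-dec (t ⊆? avoiding v))

Bridge : Edges → Fin 5 → Fin 10 → Set
Bridge g v p = ¬ Spans ((g −ᵛ v) ∖ p) v

Conflict : Edges → Fin 10 → Fin 10 → Set
Conflict g p q = p ≢ q × ∃ λ v → Bridge g v p × Bridge g v q

conflict? : ∀ g p q → Dec (Conflict g p q)
conflict? g p q = ¬? (p ≟ q) ×-dec any? λ v → ¬? (spans? ((g −ᵛ v) ∖ p) v) ×-dec ¬? (spans? ((g −ᵛ v) ∖ q) v)

permutations : ∀ n → List (Vec (Fin n) n)
permutations zero    = [] ∷ []
permutations (suc n) =
  concatMap (λ π → List.map (λ i → insertAt (Vec.map suc π) i zero) (allFin (suc n))) (permutations n)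

permutations-injective : All (λ π → ∀ x y → lookup π x ≡ lookup π y → x ≡ y) (permutations 5)
permutations-injective = from-yes (All.all? (λ π → ∀-Fin? λ x → ∀-Fin? λ y → (lookup π x ≟ lookup π y) →-dec (x ≟ y))
                                            (permutations 5))

EmbedsComplementVia : Edges → Graph 5 → Vec (Fin 5) 5 → Set
EmbedsComplementVia g H π = ∀ u v → u ≢ v → edge g u v ≡ false → Adj H (lookup π u) (lookup π v)

EmbedsComplement : Edges → Graph 5 → Set
EmbedsComplement g H = Any (EmbedsComplementVia g H) (permutations 5)

embedsComplement? : ∀ g H → Dec (EmbedsComplement g H)
embedsComplement? g H = Any.any? (λ π → ∀-Fin? λ u → ∀-Fin? λ v → ¬? (u ≟ v) →-dec
  (edge g u v Bool.≟ false) →-dec (adj H (lookup π u) (lookup π v) Bool.≟ true)) (permutations 5)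

EmbedsComplement⇒⊑ : ∀ {G H : Graph 5} → EmbedsComplement (edgesOf (adj G)) H → complement G ⊑ H
EmbedsComplement⇒⊑ {G} {H} embeds with find embeds
... | π , π∈ , via = lookup π , (λ {x} {y} → All.lookup permutations-injective π∈ x y) , preserves
  where
  preserves : ∀ u v → Adj (complement G) u v → Adj H (lookup π u) (lookup π v)
  preserves u v uv with complement-adj⁻ {G = G} uv
  ... | u≢v , non-edge = via u v u≢v (trans (edge-edgesOf (adj G) (adj-sym G) (adj-irr G) u v) non-edge)

opaque
  unfolding reach

  classification : ∀ g → (∀ v → Spans (g −ᵛ v) v) →
    EmbedsComplement g (P 5) ⊎ EmbedsComplement g (KK 2 3) ⊎ FourClique (Conflict g)
  classification = from-yes (∀-Subset? λ g → ∀-Fin? (λ v → spans? (g −ᵛ v) v) →-dec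
    (embedsComplement? g (P 5) ⊎-dec embedsComplement? g (KK 2 3) ⊎-dec fourClique? (conflict? g)))

-- Four-rainbow colourings of graphs on five vertices

module RainbowTree {G : Graph 5} {q} {c : EdgeColouring 5 q} {v : Fin 5}
                   (tree : RainbowTreeFor G c (∁ ⁅ v ⁆)) where

  private
    T : TreeIn G
    T = proj₁ tree

    E-irr : ∀ u → E T u u ≡ false
    E-irr u with E T u u in eq
    ... | true  = contradiction (trans (sym (E-adj T u u eq)) (adj-irr G u)) λ ()
    ... | false = refl

  t : Edges
  t = edgesOf (E T)

  edge-t : ∀ a b → edge t a b ≡ E T a b
  edge-t = edge-edgesOf (E T) (E-sym T) E-irr

  t⊆G : t ⊆ edgesOf (adj G)
  t⊆G p∈t = ∈-edgesOf⁺ (adj G) (E-adj T _ _ (∈-edgesOf⁻ (E T) p∈t))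

  spanning : Spans t v
  spanning {b} b∈ = EWalk⇒reach (edge t) (EWalk-map id (λ e → trans (edge-t _ _) e)
    (conn T (anchor v) b (proj₁ (proj₂ tree) _ (anchor∈ v)) (proj₁ (proj₂ tree) b b∈)))

  colour-injective : ∀ {p p′} → p ∈ t → p′ ∈ t → col c (lo p) (hi p) ≡ col c (lo p′) (hi p′) → p ≡ p′
  colour-injective {p} {p′} p∈t p′∈t same
    with proj₂ (proj₂ tree) (lo p) (hi p) (lo p′) (hi p′) (∈-edgesOf⁻ (E T) p∈t) (∈-edgesOf⁻ (E T) p′∈t) same
  ... | inj₁ (lo≡ , hi≡) = trans (sym (pairIndex-lo-hi p)) (trans (cong₂ pairIndex lo≡ hi≡) (pairIndex-lo-hi p′))
  ... | inj₂ (lo≡ , hi≡) = trans (sym (pairIndex-lo-hi p))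
                             (trans (cong₂ pairIndex lo≡ hi≡) (trans (pairIndex-sym (hi p′) (lo p′)) (pairIndex-lo-hi p′)))

  ∣t∣≤q : ∣ t ∣ ≤ q
  ∣t∣≤q = injectiveOn⇒∣p∣≤ t (λ p _ → col c (lo p) (hi p)) colour-injective

module FourRainbow {G : Graph 5} {q} (c : EdgeColouring 5 q) (rainbow : IsKRainbow 4 G c) where

  g : Edges
  g = edgesOf (adj G)

  colour : Fin 10 → Fin q
  colour p = col c (lo p) (hi p)

  module Tree (v : Fin 5) = RainbowTree {G} {q} {c} {v} (rainbow (∁ ⁅ v ⁆) (∣∁⁅x⁆∣≡n v))

  3≤q : 3 ≤ q
  3≤q = ≤-trans (spanning⇒3≤∣t∣ (Tree.t 0F) (Tree.spanning 0F)) (Tree.∣t∣≤q 0F)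

  module _ (q≤3 : q ≤ 3) where

    t⊆g−v : ∀ v → Tree.t v ⊆ g −ᵛ v
    t⊆g−v v p∈t = x∈p∩q⁺ (Tree.t⊆G v p∈t , small-spanning⇒avoiding _ v (≤-trans (Tree.∣t∣≤q v) q≤3) (Tree.spanning v) p∈t)

    g−v-spans : ∀ v → Spans (g −ᵛ v) v
    g−v-spans v = Spans-mono (t⊆g−v v) (Tree.spanning v)

    Bridge⇒∈t : ∀ {v p} → Bridge g v p → p ∈ Tree.t v
    Bridge⇒∈t {v} {p} bridge = decidable-stable (p ∈? Tree.t v) λ p∉t →
      bridge (Spans-mono {Tree.t v} {(g −ᵛ v) ∖ p} (λ x∈t → x∈p∩q⁺ (t⊆g−v v x∈t , ∈∁⁅⁆⁺ λ { refl → p∉t x∈t }))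
                         (Tree.spanning v))

    Conflict⇒colour≢ : ∀ {p p′} → Conflict g p p′ → colour p ≢ colour p′
    Conflict⇒colour≢ (p≢p′ , v , bridge , bridge′) = p≢p′ ∘ Tree.colour-injective v (Bridge⇒∈t bridge) (Bridge⇒∈t bridge′)

    no-four-clique : ¬ FourClique (Conflict g)
    no-four-clique clique = 1+n≰n (≤-trans (FourClique-≢⇒4≤ colour (FourClique-map Conflict⇒colour≢ clique)) q≤3)

    embedding : complement G ⊑ P 5 ⊎ complement G ⊑ KK 2 3
    embedding with classification g g−v-spans
    ... | inj₁ embeds        = inj₁ (EmbedsComplement⇒⊑ {G} {P 5} embeds)
    ... | inj₂ (inj₁ embeds) = inj₂ (EmbedsComplement⇒⊑ {G} {KK 2 3} embeds)
    ... | inj₂ (inj₂ clique) = ⊥-elim (no-four-clique clique)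

-- Rainbow 3-colourings of the complements of P₅ and K₂ ∪ K₃

colouringOf : ∀ {q} → Vec (Fin q) 10 → EdgeColouring 5 q
colouringOf κ = record { col = λ u v → lookup κ (pairIndex u v) ; col-sym = λ u v → cong (lookup κ) (pairIndex-sym u v) }

CertifiedTree : ∀ {q} → Graph 5 → Vec (Fin q) 10 → Edges → Fin 5 → Set
CertifiedTree H κ t v =
    (∀ a b → edge t a b ≡ true → Adj H a b × a ∈ ∁ ⁅ v ⁆ × b ∈ ∁ ⁅ v ⁆)
  × (∀ a b → edge t a b ≡ true → a ∉ reach (edge (t ∖ pairIndex a b)) b)
  × Spans t v
  × (∀ p p′ → p ∈ t → p′ ∈ t → lookup κ p ≡ lookup κ p′ → p ≡ p′)

certifiedTree? : ∀ {q} H (κ : Vec (Fin q) 10) t v → Dec (CertifiedTree H κ t v)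
certifiedTree? H κ t v =
      (∀-Fin? λ a → ∀-Fin? λ b → (edge t a b Bool.≟ true) →-dec
         ((adj H a b Bool.≟ true) ×-dec (a ∈? ∁ ⁅ v ⁆) ×-dec (b ∈? ∁ ⁅ v ⁆)))
  ×-dec (∀-Fin? λ a → ∀-Fin? λ b → (edge t a b Bool.≟ true) →-dec ¬? (a ∈? reach (edge (t ∖ pairIndex a b)) b))
  ×-dec spans? t v
  ×-dec (∀-Fin? λ p → ∀-Fin? λ p′ → (p ∈? t) →-dec (p′ ∈? t) →-dec (lookup κ p ≟ lookup κ p′) →-dec (p ≟ p′))

Outside⇒pairIndex≢ : ∀ {a b x y} → x ≢ y → a ≢ b → Outside a b x ⊎ Outside a b y → pairIndex x y ≢ pairIndex a b
Outside⇒pairIndex≢ x≢y a≢b out same = clash (pairIndex-injective _ _ _ _ x≢y a≢b same) out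
  where
  clash : ∀ {a b x y} → (x ≡ a × y ≡ b) ⊎ (x ≡ b × y ≡ a) → ¬ (Outside a b x ⊎ Outside a b y)
  clash (inj₁ (x≡a , _))   (inj₁ (x≢a , _))   = x≢a x≡a
  clash (inj₁ (_   , y≡b)) (inj₂ (_   , y≢b)) = y≢b y≡b
  clash (inj₂ (x≡b , _))   (inj₁ (_   , x≢b)) = x≢b x≡b
  clash (inj₂ (_   , y≡a)) (inj₂ (y≢a , _))   = y≢a y≡a

certified⇒RainbowTreeFor : ∀ {q H} {κ : Vec (Fin q) 10} {t v} → CertifiedTree H κ t v →
  RainbowTreeFor H (colouringOf κ) (∁ ⁅ v ⁆)
certified⇒RainbowTreeFor {H = H} {κ} {t} {v} (inH , bridgesOnly , spans , distinct) = T , (λ _ x∈ → x∈) , rainbow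
  where
  -- Every edge is a bridge, but a cycle would give an edge with a detour around it.
  acyclic : ¬ Cycle (edge t)
  acyclic cycle with cycle⇒detour cycle
  ... | a , b , ab , detour = bridgesOnly a b ab (EWalk⇒reach (edge (t ∖ pairIndex a b)) (detour keep))
    where
    keep : ∀ {x y} → edge t x y ≡ true → Outside a b x ⊎ Outside a b y → edge (t ∖ pairIndex a b) x y ≡ true
    keep {x} {y} e out with edge⁻ t {x} {y} e
    ... | x≢y , p∈t = edge⁺ (t ∖ pairIndex a b) x≢y
                        (x∈p∩q⁺ (p∈t , ∈∁⁅⁆⁺ (Outside⇒pairIndex≢ x≢y (proj₁ (edge⁻ t {a} {b} ab)) out)))

  T : TreeIn H
  T = record
    { V = ∁ ⁅ v ⁆ ; E = edge t ; E-sym = edge-sym t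
    ; E-adj = λ a b → proj₁ ∘ inH a b ; E-V = λ a b → proj₂ ∘ inH a b
    ; conn = λ a b → Spans⇒EWalk {t} {v} spans ; acyc = acyclic }

  rainbow : Rainbow (colouringOf κ) T
  rainbow u v x y e e′ same = pairIndex-injective u v x y (proj₁ (edge⁻ t {u} {v} e)) (proj₁ (edge⁻ t {x} {y} e′))
    (distinct _ _ (proj₂ (edge⁻ t {u} {v} e)) (proj₂ (edge⁻ t {x} {y} e′)) same)

edgesFrom : List (Fin 5 × Fin 5) → Edges
edgesFrom = ⋃ ∘ List.map (λ (a , b) → ⁅ pairIndex a b ⁆)

-- Colours are listed in the order of pairIndex; the entries for non-edges are irrelevant.
pathComplementColours : Vec (Fin 3) 10
pathComplementColours = 0F ∷ 0F ∷ 1F ∷ 2F ∷ 0F ∷ 2F ∷ 0F ∷ 0F ∷ 1F ∷ 0F ∷ []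

pathComplementTrees : Vec Edges 5
pathComplementTrees = edgesFrom ((1F , 3F) ∷ (1F , 4F) ∷ (2F , 4F) ∷ [])
                    ∷ edgesFrom ((0F , 2F) ∷ (0F , 3F) ∷ (0F , 4F) ∷ [])
                    ∷ edgesFrom ((0F , 3F) ∷ (0F , 4F) ∷ (1F , 4F) ∷ [])
                    ∷ edgesFrom ((0F , 4F) ∷ (1F , 4F) ∷ (2F , 4F) ∷ [])
                    ∷ edgesFrom ((0F , 2F) ∷ (0F , 3F) ∷ (1F , 3F) ∷ [])
                    ∷ []

bipartiteColours : Vec (Fin 3) 10
bipartiteColours = 0F ∷ 0F ∷ 1F ∷ 2F ∷ 1F ∷ 2F ∷ 0F ∷ 0F ∷ 0F ∷ 0F ∷ []

bipartiteTrees : Vec Edges 5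
bipartiteTrees = edgesFrom ((1F , 2F) ∷ (1F , 3F) ∷ (1F , 4F) ∷ [])
               ∷ edgesFrom ((0F , 2F) ∷ (0F , 3F) ∷ (0F , 4F) ∷ [])
               ∷ edgesFrom ((0F , 3F) ∷ (0F , 4F) ∷ (1F , 4F) ∷ [])
               ∷ edgesFrom ((0F , 2F) ∷ (0F , 4F) ∷ (1F , 2F) ∷ [])
               ∷ edgesFrom ((0F , 2F) ∷ (0F , 3F) ∷ (1F , 3F) ∷ [])
               ∷ []

opaque
  unfolding reach

  pathComplement-certified : ∀ v → CertifiedTree (complement (P 5)) pathComplementColours (lookup pathComplementTrees v) v
  pathComplement-certified = from-yes (∀-Fin? λ v →
    certifiedTree? (complement (P 5)) pathComplementColours (lookup pathComplementTrees v) v)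

  bipartite-certified : ∀ v → CertifiedTree (complement (KK 2 3)) bipartiteColours (lookup bipartiteTrees v) v
  bipartite-certified = from-yes (∀-Fin? λ v →
    certifiedTree? (complement (KK 2 3)) bipartiteColours (lookup bipartiteTrees v) v)

pathComplement-rainbow : ∀ v → RainbowTreeFor (complement (P 5)) (colouringOf pathComplementColours) (∁ ⁅ v ⁆)
pathComplement-rainbow v = certified⇒RainbowTreeFor {κ = pathComplementColours} (pathComplement-certified v)

bipartite-rainbow : ∀ v → RainbowTreeFor (complement (KK 2 3)) (colouringOf bipartiteColours) (∁ ⁅ v ⁆)
bipartite-rainbow v = certified⇒RainbowTreeFor {κ = bipartiteColours} (bipartite-certified v)

-- Connectivity of G follows from either side.
lemma2p5 : (G : Graph 5) → Connected G →
    RxEq 4 G 3 ⇔ (complement G ⊑ P 5 ⊎ complement G ⊑ KK 2 3)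
lemma2p5 G _ = mk⇔ forward backward
  where
  forward : RxEq 4 G 3 → complement G ⊑ P 5 ⊎ complement G ⊑ KK 2 3
  forward ((c , rainbow) , _) = FourRainbow.embedding {G} c rainbow ≤-refl

  backward : complement G ⊑ P 5 ⊎ complement G ⊑ KK 2 3 → RxEq 4 G 3
  backward embedding = Sum.[ complement-⊑⇒IsKRainbow {G = G} {P 5} {colouringOf pathComplementColours} pathComplement-rainbow
                           , complement-⊑⇒IsKRainbow {G = G} {KK 2 3} {colouringOf bipartiteColours} bipartite-rainbow ] embedding
                     , λ q q<3 (c , rainbow) → <⇒≱ q<3 (FourRainbow.3≤q {G} c rainbow)
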